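{- Let $n,k$ be positive integers, $s \in \mathbb{Z}_k$ and $T \subseteq \mathbb{Z}_k \setminus \{0\}$. Then $\bigcup_{t\in T} Y(s,t)$ is an independent set in the Hamming graph $H(n,k)$.
   Context: The Hamming graph $H(n,k)$ has vertex set $\mathbb{Z}_k^n$ with $\mathbb{Z}_k=\{0,1,\dots,k-1\}$, two vertices being adjacent iff they differ in exactly one coordinate; $v(i)$ is the $i$-th coordinate of $v$ and arithmetic is modulo $k$. For $v \neq (0,\dots,0)$, $\ell(v)$ is the largest index $i$ with $v(i)\neq 0$. For $s,t\in\mathbb{Z}_k$ with $t\neq 0$, $Y(s,t)$ is the set of nonzero vertices $v$ with $\sum_{i=1}^n v(i)\equiv s \pmod k$ and $v(\ell(v)) = t$. -}

module Defs where

open import Data.Nat using (ℕ; zero; suc; _+_; NonZero)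
open import Data.Nat.DivMod using (_mod_)
open import Data.Fin using (Fin; zero; suc; toℕ; fromℕ; inject₁)
open import Data.Maybe using (Maybe; just; nothing)
open import Data.Product using (Σ; ∃; _×_; _,_)
open import Relation.Binary.PropositionalEquality using (_≡_; _≢_)
open import Relation.Nullary using (¬_; yes; no)
open import Data.Fin using (_≟_)

-- Z_k = Fin k; vertices of H(n,k) are maps from coordinates (Fin n,
-- coordinate i+1 of the paper is index i here) to Z_k.
Vertex : ℕ → ℕ → Set
Vertex n k = Fin n → Fin k

zeroₖ : ∀ {k} → Fin (suc k)
zeroₖ = zero

Adjacent : ∀ {n k} → Vertex n k → Vertex n k → Set
Adjacent {n} v w = Σ (Fin n) λ i → (v i ≢ w i) × (∀ j → j ≢ i → v j ≡ w j)

IsZeroVertex : ∀ {n k} → Vertex n (suc k) → Set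
IsZeroVertex v = ∀ i → v i ≡ zero

coordSum : ∀ {n k} → Vertex n k → ℕ
coordSum {zero} v = zero
coordSum {suc n} v = toℕ (v zero) + coordSum {n} (λ i → v (suc i))

sumMod : ∀ {n k} → Vertex n (suc k) → Fin (suc k)
sumMod {n} {k} v = coordSum v mod (suc k)

-- ℓ(v): largest index with nonzero coordinate (nothing if v = 0)
ℓ : ∀ {n k} → Vertex n (suc k) → Maybe (Fin n)
ℓ {zero} v = nothing
ℓ {suc n} v with ℓ {n} (λ i → v (suc i))
... | just i = just (suc i)
... | nothing with v zero ≟ zero
...   | yes _ = nothing
...   | no _ = just zero

InY : ∀ {n k} → Fin (suc k) → Fin (suc k) → Vertex n (suc k) → Set
InY s t v = (¬ IsZeroVertex v) × (sumMod v ≡ s)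
          × Σ _ (λ i → (ℓ v ≡ just i) × (v i ≡ t))

Independent : ∀ {n k} → (Vertex n k → Set) → Set
Independent {n} {k} S = ∀ (v w : Vertex n k) → S v → S w → ¬ Adjacent v w

{-# OPTIONS --safe #-}
-- Two adjacent vertices differ in a single coordinate, by a nonzero amount
-- smaller than k, so their coordinate sums differ modulo k.  Every vertex of
-- a union of sets Y(s,t) has coordinate sum s, so no two of them are adjacent;
-- the conditions on the last nonzero coordinate and on T play no role.
module Submission where

open import Defs
open import Data.Nat using (ℕ; zero; suc; _+_; _*_; _∸_; _%_; _/_; _<_; NonZero)
open import Data.Nat.Properties using (+-comm; +-assoc; m∸n+n≡m)
open import Data.Nat.DivMod
  using (%-distribˡ-+; m%n≤n; m%n<n; m≡m%n+[m/n]*n; [m+kn]%n≡m%n; m<n⇒m%n≡m)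
open import Data.Nat.Solver using (module +-*-Solver)
open import Data.Fin using (Fin; zero; suc; toℕ)
open import Data.Fin.Properties using (toℕ-injective; toℕ<n; toℕ-fromℕ<; suc-injective)
open import Data.Product using (Σ; _×_; _,_)
open import Relation.Binary.PropositionalEquality
open ≡-Reasoning

coordSum-cong : ∀ {n k} {v w : Vertex n k} → (∀ j → v j ≡ w j) → coordSum v ≡ coordSum w
coordSum-cong {zero}  v≗w = refl
coordSum-cong {suc n} v≗w = cong₂ _+_ (cong toℕ (v≗w zero)) (coordSum-cong (λ j → v≗w (suc j)))

coordSum-exchange : ∀ {n k} (v w : Vertex n k) (i : Fin n) → (∀ j → j ≢ i → v j ≡ w j)
                  → coordSum v + toℕ (w i) ≡ coordSum w + toℕ (v i)
coordSum-exchange {suc n} v w zero agree = begin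
  (a + S) + b  ≡⟨ cong (λ S′ → (a + S′) + b) (coordSum-cong (λ j → agree (suc j) λ ())) ⟩
  (a + S′) + b ≡⟨ solve 3 (λ a S′ b → (a :+ S′) :+ b := (b :+ S′) :+ a) refl a S′ b ⟩
  (b + S′) + a ∎
  where
  open +-*-Solver
  a b S S′ : ℕ
  a = toℕ (v zero)
  b = toℕ (w zero)
  S = coordSum (λ j → v (suc j))
  S′ = coordSum (λ j → w (suc j))
coordSum-exchange {suc n} v w (suc i) agree = begin
  (v₀ + S) + toℕ (w (suc i)) ≡⟨ +-assoc v₀ S _ ⟩
  v₀ + (S + toℕ (w (suc i))) ≡⟨ cong₂ _+_ (cong toℕ (agree zero λ ())) tail-exchange ⟩
  w₀ + (S′ + toℕ (v (suc i))) ≡⟨ +-assoc w₀ S′ _ ⟨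
  (w₀ + S′) + toℕ (v (suc i)) ∎
  where
  v₀ w₀ S S′ : ℕ
  v₀ = toℕ (v zero)
  w₀ = toℕ (w zero)
  S = coordSum (λ j → v (suc j))
  S′ = coordSum (λ j → w (suc j))
  tail-exchange : S + toℕ (w (suc i)) ≡ S′ + toℕ (v (suc i))
  tail-exchange = coordSum-exchange (λ j → v (suc j)) (λ j → w (suc j)) i
    (λ j j≢i → agree (suc j) (λ sj≡si → j≢i (suc-injective sj≡si)))

module _ (m : ℕ) .{{_ : NonZero m}} where

  %-congʳ-+ : ∀ c {a b} → a % m ≡ b % m → (c + a) % m ≡ (c + b) % m
  %-congʳ-+ c {a} {b} a≡b = begin
    (c + a) % m           ≡⟨ %-distribˡ-+ c a m ⟩
    (c % m + a % m) % m   ≡⟨ cong (λ r → (c % m + r) % m) a≡b ⟩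
    (c % m + b % m) % m   ≡⟨ %-distribˡ-+ c b m ⟨
    (c + b) % m           ∎

  %-+-inverseˡ : ∀ c z → ((m ∸ c % m) + (c + z)) % m ≡ z % m
  %-+-inverseˡ c z = begin
    (r + (c + z)) % m                  ≡⟨ cong (λ c′ → (r + (c′ + z)) % m) (m≡m%n+[m/n]*n c m) ⟩
    (r + ((c % m + q * m) + z)) % m    ≡⟨ cong (_% m) (regroup r (c % m) (q * m) z) ⟩
    (z + (r + c % m + q * m)) % m      ≡⟨ cong (λ x → (z + (x + q * m)) % m) (m∸n+n≡m (m%n≤n c m)) ⟩
    (z + suc q * m) % m                ≡⟨ [m+kn]%n≡m%n z (suc q) m ⟩
    z % m                              ∎
    where
    open +-*-Solver
    r q : ℕ
    r = m ∸ c % m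
    q = c / m
    regroup : ∀ r a p z → r + ((a + p) + z) ≡ z + (r + a + p)
    regroup = solve 4 (λ r a p z → r :+ ((a :+ p) :+ z) := z :+ (r :+ a :+ p)) refl

  +-cancelˡ-% : ∀ c {x y} → x < m → y < m → (c + x) % m ≡ (c + y) % m → x ≡ y
  +-cancelˡ-% c {x} {y} x<m y<m c+x≡c+y = begin
    x                                   ≡⟨ m<n⇒m%n≡m x<m ⟨
    x % m                               ≡⟨ %-+-inverseˡ c x ⟨
    ((m ∸ c % m) + (c + x)) % m         ≡⟨ %-congʳ-+ (m ∸ c % m) c+x≡c+y ⟩
    ((m ∸ c % m) + (c + y)) % m         ≡⟨ %-+-inverseˡ c y ⟩
    y % m                               ≡⟨ m<n⇒m%n≡m y<m ⟩
    y                                   ∎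

toℕ-sumMod : ∀ {n k} (v : Vertex n (suc k)) → toℕ (sumMod v) ≡ coordSum v % suc k
toℕ-sumMod {k = k} v = toℕ-fromℕ< (m%n<n (coordSum v) (suc k))

adjacent⇒sumMod-≢ : ∀ {n k} {v w : Vertex n (suc k)} → Adjacent v w → sumMod v ≢ sumMod w
adjacent⇒sumMod-≢ {k = k} {v} {w} (i , vᵢ≢wᵢ , agree) Σv≡Σw =
  vᵢ≢wᵢ (toℕ-injective (+-cancelˡ-% m B (toℕ<n (v i)) (toℕ<n (w i)) shifted))
  where
  m A B : ℕ
  m = suc k
  A = coordSum v
  B = coordSum w
  A≡B : A % m ≡ B % m
  A≡B = trans (sym (toℕ-sumMod v)) (trans (cong toℕ Σv≡Σw) (toℕ-sumMod w))
  shifted : (B + toℕ (v i)) % m ≡ (B + toℕ (w i)) % m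
  shifted = begin
    (B + toℕ (v i)) % m ≡⟨ cong (_% m) (coordSum-exchange v w i agree) ⟨
    (A + toℕ (w i)) % m ≡⟨ cong (_% m) (+-comm A _) ⟩
    (toℕ (w i) + A) % m ≡⟨ %-congʳ-+ m (toℕ (w i)) A≡B ⟩
    (toℕ (w i) + B) % m ≡⟨ cong (_% m) (+-comm _ B) ⟩
    (B + toℕ (w i)) % m ∎

sumMod-fiber-independent : ∀ {n k} (s : Fin (suc k)) → Independent {n} (λ v → sumMod v ≡ s)
sumMod-fiber-independent s v w Σv≡s Σw≡s v~w = adjacent⇒sumMod-≢ v~w (trans Σv≡s (sym Σw≡s))

lemma12 : (n k : ℕ) → (s : Fin (suc k)) → (T : Fin (suc k) → Set)
          → (∀ t → T t → t ≢ zero)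
          → Independent {suc n} {suc k} (λ v → Σ (Fin (suc k)) λ t → T t × InY s t v)
lemma12 n k s T _ v w (_ , _ , _ , Σv≡s , _) (_ , _ , _ , Σw≡s , _) =
  sumMod-fiber-independent s v w Σv≡s Σw≡s
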